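{- Let $\epsilon$ and $\delta$ be real numbers with $0<\epsilon<\frac{2}{5}$ and $0<\delta\le\frac{1}{20}$, and let $\tau$ be a positive integer. Suppose that $\Gamma$ is a connected $D$-regular graph on $n$ vertices such that $\|Q^{\tau}_v-U\|<2\delta$ for at least $\epsilon n$ vertices $v$. Then every vertex set $X\subseteq V(\Gamma)$ with $4\delta n\le|X|\le\frac12 n$ satisfies $e(X,V(\Gamma)\setminus X)\ge\frac{\epsilon D}{8\tau}|X|$.
   Context: All graphs are finite simple graphs; $D\ge1$. The random walk on $\Gamma$ moves at each step to a uniformly random neighbor of the current vertex, independently of the history; $Q^t_v$ denotes the distribution of the position after $t$ steps of the walk started at $v$. $U$ is the uniform distribution on $V(\Gamma)$, and $\|P_1-P_2\|=\max_{A}|P_1(A)-P_2(A)|$ is the total variation distance. $e(X,Y)$ is the number of edges with one endpoint in $X$ and the other in $Y$.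
   Formalization: The parameters ε and δ are rational numbers rather than real numbers. -}

module Defs where

open import Data.Bool using (Bool; true; false; if_then_else_)
open import Data.Nat as ℕ using (ℕ; zero; suc)
open import Data.Integer using (+_)
open import Data.Fin using (Fin; zero; suc)
open import Data.Fin.Subset using (Subset; _∈_)
open import Data.Vec using (Vec; []; _∷_; lookup)
open import Data.List using (List; []; _∷_; map; _++_)
open import Data.Rational as ℚ using (ℚ; 0ℚ; 1ℚ; _+_; _-_; _*_; _/_; _⊔_; ∣_∣)
open import Relation.Binary.PropositionalEquality using (_≡_)
open import Relation.Nullary.Decidable using (⌊_⌋)
import Data.Rational.Properties as ℚP

toℚ : ℕ → ℚ
toℚ k = + k / 1

record Graph (n : ℕ) : Set where
  field
    adj     : Fin n → Fin n → Bool
    symm    : ∀ u v → adj u v ≡ adj v u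
    irrefl  : ∀ v → adj v v ≡ false
open Graph public

sumℕ : ∀ {n} → (Fin n → ℕ) → ℕ
sumℕ {zero}  f = 0
sumℕ {suc n} f = f zero ℕ.+ sumℕ (λ i → f (suc i))

sumℚ : ∀ {n} → (Fin n → ℚ) → ℚ
sumℚ {zero}  f = 0ℚ
sumℚ {suc n} f = f zero + sumℚ (λ i → f (suc i))

𝟙 : Bool → ℕ
𝟙 true  = 1
𝟙 false = 0

deg : ∀ {n} → Graph n → Fin n → ℕ
deg G v = sumℕ (λ w → 𝟙 (adj G v w))

-- 1/k, with the convention 1/0 = 0 (only relevant for isolated vertices)
inv : ℕ → ℚ
inv zero    = 0ℚ
inv (suc k) = + 1 / suc k

Regular : ∀ {n} → Graph n → ℕ → Set
Regular G D = ∀ v → deg G v ≡ D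

data Reach {n} (G : Graph n) : Fin n → Fin n → Set where
  here : ∀ {v} → Reach G v v
  step : ∀ {u w v} → adj G u w ≡ true → Reach G w v → Reach G u v

Connected : ∀ {n} → Graph n → Set
Connected {n} G = ∀ (u v : Fin n) → Reach G u v

_==_ : ∀ {n} → Fin n → Fin n → Bool
zero  == zero  = true
zero  == suc _ = false
suc _ == zero  = false
suc i == suc j = i == j

Dist : ℕ → Set
Dist n = Fin n → ℚ

-- Q^t_v : distribution of the simple random walk after t steps started at v
Q : ∀ {n} → Graph n → ℕ → Fin n → Dist n
Q G zero    v u = if u == v then 1ℚ else 0ℚ
Q G (suc t) v u = sumℚ (λ w → if adj G w u then Q G t v w * inv (deg G w) else 0ℚ)

Unif : (n : ℕ) → Dist n
Unif n u = inv n

prob : ∀ {n} → Dist n → Subset n → ℚ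
prob P A = sumℚ (λ u → if lookup A u then P u else 0ℚ)

allSubsets : (n : ℕ) → List (Subset n)
allSubsets zero    = [] ∷ []
allSubsets (suc n) = map (true ∷_) (allSubsets n) ++ map (false ∷_) (allSubsets n)

maxList : List ℚ → ℚ
maxList []       = 0ℚ
maxList (x ∷ xs) = x ⊔ maxList xs

tv : ∀ {n} → Dist n → Dist n → ℚ
tv {n} P₁ P₂ = maxList (map (λ A → ∣ prob P₁ A - prob P₂ A ∣) (allSubsets n))

countV : ∀ {n} → (Fin n → Bool) → ℕ
countV p = sumℕ (λ v → 𝟙 (p v))

-- e(X, Y): number of edges with one endpoint in X, the other in Y
-- (for disjoint X, Y this counts ordered pairs (x,y) with x ∈ X, y ∈ Y adjacent)
eX : ∀ {n} → Graph n → Subset n → Subset n → ℕ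
eX G X Y = sumℕ (λ x → sumℕ (λ y →
  if lookup X x then (if lookup Y y then 𝟙 (adj G x y) else 0) else 0))

_<ᵇℚ_ : ℚ → ℚ → Bool
p <ᵇℚ q = ⌊ p ℚP.<? q ⌋

-- Start one walker at every vertex of X.  In a D-regular graph the transition matrix is doubly
-- stochastic, so the expected number of walkers at any vertex never exceeds 1; hence each step
-- moves at most e(X, ∁X)/D of them from X into ∁X, and after τ steps at most E = τ e(X, ∁X)/D
-- walkers are expected in ∁X.  The same holds for walkers started in ∁X and ending in X.
-- Conversely, a vertex v with ‖Q^τ_v − U‖ < 2δ puts mass at least U(Y) − 2δ on any set Y.  With
-- a (resp. b) such vertices in X (resp. ∁X) and κ = |X|/n this gives a(1 − κ − 2δ) ≤ E and
-- b(κ − 2δ) ≤ E, while a + b ≥ εn; as 4δ ≤ κ ≤ 1/2 and δ ≤ 1/20 this forces εκn ≤ 8E.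

module Submission where

open import Defs
open import Data.Bool using (Bool; true; false; if_then_else_; not; T)
open import Data.Bool.Properties using (if-float; if-swap-then; if-cong-then; not-involutive)
open import Data.Nat as ℕ using (ℕ; zero; suc)
open import Data.Nat.Coprimality as Coprime using (1-coprimeTo)
open import Data.Integer as ℤ using (+_; -[1+_])
import Data.Integer.Properties as ℤP
open import Data.Fin using (Fin; zero; suc)
open import Data.Fin.Subset using (Subset; ∁; ∣_∣)
open import Data.Vec using ([]; _∷_; lookup)
open import Data.Vec.Properties using (lookup-map)
open import Data.List using (_∷_; map)
open import Data.List.Membership.Propositional using (_∈_)
open import Data.List.Membership.Propositional.Properties using (∈-map⁺; ∈-++⁺ˡ; ∈-++⁺ʳ)
open import Data.List.Relation.Unary.Any using (here; there)
open import Data.Rational as ℚ using (ℚ; mkℚ; 0ℚ; 1ℚ; _<_; _≤_; _*_; _+_; _-_; -_; _/_; *≤*)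
import Data.Rational.Properties as ℚP
open import Data.Rational.Solver using (module +-*-Solver)
open import Data.Unit using (tt)
open import Algebra.Bundles using (Ring)
import Algebra.Properties.Semiring.Sum as SemiringSum
open import Function using (_∘_)
open import Relation.Nullary.Decidable using (toWitness)
open import Relation.Binary.PropositionalEquality
open +-*-Solver

module ∑ = SemiringSum (Ring.semiring ℚP.+-*-ring)

-- Natural numbers and their inverses in ℚ

toℚ≡mkℚ : ∀ k → toℚ k ≡ mkℚ (+ k) 0 (Coprime.sym (1-coprimeTo k))
toℚ≡mkℚ k = ℚP.↥p/↧p≡p (mkℚ (+ k) 0 (Coprime.sym (1-coprimeTo k)))

inv≡mkℚ : ∀ k → inv (suc k) ≡ mkℚ (+ 1) k (1-coprimeTo (suc k))
inv≡mkℚ k = ℚP.↥p/↧p≡p (mkℚ (+ 1) k (1-coprimeTo (suc k)))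

toℚ-+ : ∀ m n → toℚ (m ℕ.+ n) ≡ toℚ m + toℚ n
toℚ-+ m n rewrite toℚ≡mkℚ m | toℚ≡mkℚ n =
  ℚP./-cong (sym (cong₂ ℤ._+_ (ℤP.*-identityʳ (+ m)) (ℤP.*-identityʳ (+ n)))) refl

toℚ-* : ∀ m n → toℚ (m ℕ.* n) ≡ toℚ m * toℚ n
toℚ-* zero    n = sym (ℚP.*-zeroˡ (toℚ n))
toℚ-* (suc m) n = begin
  toℚ (n ℕ.+ m ℕ.* n)        ≡⟨ toℚ-+ n (m ℕ.* n) ⟩
  toℚ n + toℚ (m ℕ.* n)      ≡⟨ cong₂ _+_ (sym (ℚP.*-identityˡ (toℚ n))) (toℚ-* m n) ⟩
  1ℚ * toℚ n + toℚ m * toℚ n ≡⟨ ℚP.*-distribʳ-+ (toℚ n) 1ℚ (toℚ m) ⟨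
  (1ℚ + toℚ m) * toℚ n       ≡⟨ cong (_* toℚ n) (toℚ-+ 1 m) ⟨
  toℚ (suc m) * toℚ n        ∎
  where open ≡-Reasoning

toℚ-mono-≤ : ∀ {m n} → m ℕ.≤ n → toℚ m ≤ toℚ n
toℚ-mono-≤ {m} {n} m≤n rewrite toℚ≡mkℚ m | toℚ≡mkℚ n =
  *≤* (subst₂ ℤ._≤_ (sym (ℤP.*-identityʳ (+ m))) (sym (ℤP.*-identityʳ (+ n))) (ℤ.+≤+ m≤n))

0≤toℚ : ∀ n → 0ℚ ≤ toℚ n
0≤toℚ n = toℚ-mono-≤ {0} {n} ℕ.z≤n

0≤inv : ∀ n → 0ℚ ≤ inv n
0≤inv zero    = ℚP.≤-refl
0≤inv (suc k) = subst (0ℚ ≤_) (sym (inv≡mkℚ k)) (ℚP.nonNegative⁻¹ (mkℚ (+ 1) k (1-coprimeTo (suc k))))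

toℚ*inv≡1 : ∀ n .{{_ : ℕ.NonZero n}} → toℚ n * inv n ≡ 1ℚ
toℚ*inv≡1 (suc k) = trans (cong₂ _*_ (toℚ≡mkℚ (suc k)) (inv≡mkℚ k))
  (ℚP.*-inverseʳ (mkℚ (+ suc k) 0 (Coprime.sym (1-coprimeTo (suc k)))))

x*n*inv-n≡x : ∀ x n .{{_ : ℕ.NonZero n}} → x * toℚ n * inv n ≡ x
x*n*inv-n≡x x n = begin
  x * toℚ n * inv n   ≡⟨ ℚP.*-assoc x (toℚ n) (inv n) ⟩
  x * (toℚ n * inv n) ≡⟨ cong (x *_) (toℚ*inv≡1 n) ⟩
  x * 1ℚ              ≡⟨ ℚP.*-identityʳ x ⟩
  x                   ∎
  where open ≡-Reasoning

x*inv-n*n≡x : ∀ x n .{{_ : ℕ.NonZero n}} → x * inv n * toℚ n ≡ x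
x*inv-n*n≡x x n = trans (ℚP.*-assoc x (inv n) (toℚ n))
  (trans (cong (x *_) (trans (ℚP.*-comm (inv n) (toℚ n)) (toℚ*inv≡1 n))) (ℚP.*-identityʳ x))

0≤p+q : ∀ {p q} → 0ℚ ≤ p → 0ℚ ≤ q → 0ℚ ≤ p + q
0≤p+q = ℚP.+-mono-≤

0≤p*q : ∀ {p q} → 0ℚ ≤ p → 0ℚ ≤ q → 0ℚ ≤ p * q
0≤p*q {p} {q} 0≤p 0≤q =
  ℚP.nonNegative⁻¹ (p * q) {{ℚP.nonNeg*nonNeg⇒nonNeg p {{ℚ.nonNegative 0≤p}} q {{ℚ.nonNegative 0≤q}}}}

*-monoʳ-≤-0≤ : ∀ {p q} r → 0ℚ ≤ r → p ≤ q → p * r ≤ q * r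
*-monoʳ-≤-0≤ r 0≤r = ℚP.*-monoʳ-≤-nonNeg r {{ℚ.nonNegative 0≤r}}

*-monoˡ-≤-0≤ : ∀ {p q} r → 0ℚ ≤ r → p ≤ q → r * p ≤ r * q
*-monoˡ-≤-0≤ r 0≤r = ℚP.*-monoˡ-≤-nonNeg r {{ℚ.nonNegative 0≤r}}

p≤q⇒0≤q-p : ∀ {p q} → p ≤ q → 0ℚ ≤ q - p
p≤q⇒0≤q-p {p} {q} p≤q = subst (_≤ q - p) (ℚP.+-inverseʳ p) (ℚP.+-monoˡ-≤ (- p) p≤q)

≤-by-slack : ∀ {x y} s → 0ℚ ≤ s → x + s ≡ y → x ≤ y
≤-by-slack {x} s 0≤s x+s≡y = subst₂ _≤_ (ℚP.+-identityʳ x) x+s≡y (ℚP.+-monoʳ-≤ x 0≤s)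

p*n≤q⇒p≤q*inv-n : ∀ {p q} n .{{_ : ℕ.NonZero n}} → p * toℚ n ≤ q → p ≤ q * inv n
p*n≤q⇒p≤q*inv-n {p} {q} n p*n≤q = subst (_≤ q * inv n) (x*n*inv-n≡x p n) (*-monoʳ-≤-0≤ (inv n) (0≤inv n) p*n≤q)

p≤q*n⇒p*inv-n≤q : ∀ {p q} n .{{_ : ℕ.NonZero n}} → p ≤ q * toℚ n → p * inv n ≤ q
p≤q*n⇒p*inv-n≤q {p} {q} n p≤q*n = subst (p * inv n ≤_) (x*n*inv-n≡x q n) (*-monoʳ-≤-0≤ (inv n) (0≤inv n) p≤q*n)

-- Finite sums

sumℚ≡∑ : ∀ {n} (f : Fin n → ℚ) → sumℚ f ≡ ∑.sum f
sumℚ≡∑ {zero}  f = refl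
sumℚ≡∑ {suc n} f = cong (_+_ (f zero)) (sumℚ≡∑ (f ∘ suc))

sumℚ²≡∑² : ∀ {m n} (f : Fin m → Fin n → ℚ) → sumℚ (λ i → sumℚ (f i)) ≡ ∑.sum (λ i → ∑.sum (f i))
sumℚ²≡∑² f = trans (sumℚ≡∑ (λ i → sumℚ (f i))) (∑.sum-cong-≗ (λ i → sumℚ≡∑ (f i)))

sumℚ-cong : ∀ {n} {f g : Fin n → ℚ} → (∀ i → f i ≡ g i) → sumℚ f ≡ sumℚ g
sumℚ-cong {f = f} {g} f≗g = trans (sumℚ≡∑ f) (trans (∑.sum-cong-≗ f≗g) (sym (sumℚ≡∑ g)))

sumℚ-zero : ∀ n → sumℚ {n} (λ _ → 0ℚ) ≡ 0ℚ
sumℚ-zero n = trans (sumℚ≡∑ {n} (λ _ → 0ℚ)) (∑.sum-replicate-zero n)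

sumℚ-+ : ∀ {n} (f g : Fin n → ℚ) → sumℚ (λ i → f i + g i) ≡ sumℚ f + sumℚ g
sumℚ-+ f g = trans (sumℚ≡∑ (λ i → f i + g i)) (trans (∑.∑-distrib-+ f g) (sym (cong₂ _+_ (sumℚ≡∑ f) (sumℚ≡∑ g))))

sumℚ-*ʳ : ∀ {n} (f : Fin n → ℚ) c → sumℚ (λ i → f i * c) ≡ sumℚ f * c
sumℚ-*ʳ f c = trans (sumℚ≡∑ (λ i → f i * c)) (trans (sym (∑.*-distribʳ-sum c f)) (cong (_* c) (sym (sumℚ≡∑ f))))

sumℚ-comm : ∀ {m n} (f : Fin m → Fin n → ℚ) →
  sumℚ (λ i → sumℚ (f i)) ≡ sumℚ (λ j → sumℚ (λ i → f i j))
sumℚ-comm f = trans (sumℚ²≡∑² f) (trans (∑.∑-comm f) (sym (sumℚ²≡∑² (λ j i → f i j))))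

sumℚ-mono-≤ : ∀ {n} {f g : Fin n → ℚ} → (∀ i → f i ≤ g i) → sumℚ f ≤ sumℚ g
sumℚ-mono-≤ {zero}  f≤g = ℚP.≤-refl
sumℚ-mono-≤ {suc n} f≤g = ℚP.+-mono-≤ (f≤g zero) (sumℚ-mono-≤ (f≤g ∘ suc))

0≤sumℚ : ∀ {n} {f : Fin n → ℚ} → (∀ i → 0ℚ ≤ f i) → 0ℚ ≤ sumℚ f
0≤sumℚ {n} {f} 0≤f = subst (_≤ sumℚ f) (sumℚ-zero n) (sumℚ-mono-≤ 0≤f)

toℚ-sumℕ : ∀ {n} (f : Fin n → ℕ) → toℚ (sumℕ f) ≡ sumℚ (toℚ ∘ f)
toℚ-sumℕ {zero}  f = refl
toℚ-sumℕ {suc n} f = trans (toℚ-+ (f zero) _) (cong (_+_ (toℚ (f zero))) (toℚ-sumℕ (f ∘ suc)))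

sumℚ-const : ∀ n c → sumℚ {n} (λ _ → c) ≡ toℚ n * c
sumℚ-const zero    c = sym (ℚP.*-zeroˡ c)
sumℚ-const (suc n) c = begin
  c + sumℚ {n} (λ _ → c) ≡⟨ cong₂ _+_ (sym (ℚP.*-identityˡ c)) (sumℚ-const n c) ⟩
  1ℚ * c + toℚ n * c     ≡⟨ ℚP.*-distribʳ-+ c 1ℚ (toℚ n) ⟨
  (1ℚ + toℚ n) * c       ≡⟨ cong (_* c) (toℚ-+ 1 n) ⟨
  toℚ (suc n) * c        ∎
  where open ≡-Reasoning

sumℚ-delta : ∀ {n} (u : Fin n) (f : Fin n → ℚ) → sumℚ (λ v → if u == v then f v else 0ℚ) ≡ f u
sumℚ-delta {suc n} zero    f = trans (cong (_+_ (f zero)) (sumℚ-zero n)) (ℚP.+-identityʳ (f zero))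
sumℚ-delta {suc n} (suc u) f = trans (ℚP.+-identityˡ _) (sumℚ-delta u (f ∘ suc))

if-sum : ∀ {n} b (f : Fin n → ℚ) → (if b then sumℚ f else 0ℚ) ≡ sumℚ (λ i → if b then f i else 0ℚ)
if-sum     true  f = refl
if-sum {n} false f = sym (sumℚ-zero n)

if-*ʳ : ∀ b x c → (if b then x * c else 0ℚ) ≡ (if b then x else 0ℚ) * c
if-*ʳ true  x c = refl
if-*ʳ false x c = sym (ℚP.*-zeroˡ c)

if-𝟙 : ∀ b x → (if b then x else 0ℚ) ≡ toℚ (𝟙 b) * x
if-𝟙 true  x = sym (ℚP.*-identityˡ x)
if-𝟙 false x = sym (ℚP.*-zeroˡ x)

∁-involutive : ∀ {n} (X : Subset n) → ∁ (∁ X) ≡ X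
∁-involutive []      = refl
∁-involutive (x ∷ X) = cong₂ _∷_ (not-involutive x) (∁-involutive X)

sumℚ-split : ∀ {n} (X : Subset n) (f : Fin n → ℚ) →
  sumℚ f ≡ sumℚ (λ v → if lookup X v then f v else 0ℚ) + sumℚ (λ v → if lookup (∁ X) v then f v else 0ℚ)
sumℚ-split X f = trans (sumℚ-cong split)
  (sumℚ-+ (λ v → if lookup X v then f v else 0ℚ) (λ v → if lookup (∁ X) v then f v else 0ℚ))
  where
  split : ∀ v → f v ≡ (if lookup X v then f v else 0ℚ) + (if lookup (∁ X) v then f v else 0ℚ)
  split v rewrite lookup-map v not X with lookup X v
  ... | true  = sym (ℚP.+-identityʳ (f v))
  ... | false = sym (ℚP.+-identityˡ (f v))

sumℕ-𝟙≡∣p∣ : ∀ {n} (p : Subset n) → sumℕ (λ u → 𝟙 (lookup p u)) ≡ ∣ p ∣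
sumℕ-𝟙≡∣p∣ []          = refl
sumℕ-𝟙≡∣p∣ (true  ∷ p) = cong suc (sumℕ-𝟙≡∣p∣ p)
sumℕ-𝟙≡∣p∣ (false ∷ p) = sumℕ-𝟙≡∣p∣ p

-- Probabilities and total variation

0≤prob : ∀ {n} (P : Dist n) (A : Subset n) → (∀ u → 0ℚ ≤ P u) → 0ℚ ≤ prob P A
0≤prob P A 0≤P = 0≤sumℚ 0≤term
  where
  0≤term : ∀ u → 0ℚ ≤ (if lookup A u then P u else 0ℚ)
  0≤term u with lookup A u
  ... | true  = 0≤P u
  ... | false = ℚP.≤-refl

prob-∁ : ∀ {n} (P : Dist n) (A : Subset n) → prob P (∁ A) ≡ sumℚ P - prob P A
prob-∁ P A = begin
  prob P (∁ A)                        ≡⟨ solve 2 (λ a b → b := a :+ b :- a) refl (prob P A) (prob P (∁ A)) ⟩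
  prob P A + prob P (∁ A) - prob P A  ≡⟨ cong (_- prob P A) (sumℚ-split A P) ⟨
  sumℚ P - prob P A                   ∎
  where open ≡-Reasoning

sumℚ-Unif : ∀ k → sumℚ (Unif (suc k)) ≡ 1ℚ
sumℚ-Unif k = trans (sumℚ-const (suc k) (inv (suc k))) (toℚ*inv≡1 (suc k))

prob-Unif : ∀ {n} (A : Subset n) → prob (Unif n) A ≡ toℚ ∣ A ∣ * inv n
prob-Unif {n} A = begin
  prob (Unif n) A                            ≡⟨ sumℚ-cong (λ u → if-𝟙 (lookup A u) (inv n)) ⟩
  sumℚ (λ u → toℚ (𝟙 (lookup A u)) * inv n) ≡⟨ sumℚ-*ʳ (toℚ ∘ 𝟙 ∘ lookup A) (inv n) ⟩
  sumℚ (toℚ ∘ 𝟙 ∘ lookup A) * inv n          ≡⟨ cong (_* inv n) (toℚ-sumℕ (𝟙 ∘ lookup A)) ⟨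
  toℚ (sumℕ (𝟙 ∘ lookup A)) * inv n          ≡⟨ cong (λ k → toℚ k * inv n) (sumℕ-𝟙≡∣p∣ A) ⟩
  toℚ ∣ A ∣ * inv n                          ∎
  where open ≡-Reasoning

∈-allSubsets : ∀ {n} (A : Subset n) → A ∈ allSubsets n
∈-allSubsets []                = here refl
∈-allSubsets {suc n} (true  ∷ A) = ∈-++⁺ˡ (∈-map⁺ (true ∷_) (∈-allSubsets A))
∈-allSubsets {suc n} (false ∷ A) = ∈-++⁺ʳ (map (true ∷_) (allSubsets n)) (∈-map⁺ (false ∷_) (∈-allSubsets A))

∈⇒≤-maxList : ∀ {x xs} → x ∈ xs → x ≤ maxList xs
∈⇒≤-maxList {x} {_ ∷ ys}  (here refl) = ℚP.p≤p⊔q x (maxList ys)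
∈⇒≤-maxList {xs = y ∷ ys} (there x∈ys) = ℚP.≤-trans (∈⇒≤-maxList x∈ys) (ℚP.p≤q⊔p y (maxList ys))

∣prob-prob∣≤tv : ∀ {n} (P R : Dist n) A → ℚ.∣ prob P A - prob R A ∣ ≤ tv P R
∣prob-prob∣≤tv P R A = ∈⇒≤-maxList (∈-map⁺ (λ B → ℚ.∣ prob P B - prob R B ∣) (∈-allSubsets A))

p≤∣p∣ : ∀ p → p ≤ ℚ.∣ p ∣
p≤∣p∣ p@(mkℚ (+ _)    _ _) = ℚP.≤-refl
p≤∣p∣ p@(mkℚ -[1+ _ ] _ _) = ℚP.≤-trans (ℚP.nonPositive⁻¹ p) (ℚP.0≤∣p∣ p)

tv<⇒prob-lower : ∀ {n} (P R : Dist n) A {d} → tv P R < d → prob R A - d ≤ prob P A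
tv<⇒prob-lower P R A {d} tv<d = begin
  x - d             ≡⟨ solve 3 (λ x y d → x :- d := (x :- y) :+ (y :- d)) refl x y d ⟩
  (x - y) + (y - d) ≤⟨ ℚP.+-monoˡ-≤ (y - d) x-y≤d ⟩
  d + (y - d)       ≡⟨ solve 2 (λ y d → d :+ (y :- d) := y) refl y d ⟩
  y                 ∎
  where
  open ℚP.≤-Reasoning
  x = prob R A
  y = prob P A
  x-y≤d : x - y ≤ d
  x-y≤d = begin
    x - y           ≤⟨ p≤∣p∣ (x - y) ⟩
    ℚ.∣ x - y ∣     ≡⟨ cong ℚ.∣_∣ (solve 2 (λ x y → x :- y := :- (y :- x)) refl x y) ⟩
    ℚ.∣ - (y - x) ∣ ≡⟨ ℚP.∣-p∣≡∣p∣ (y - x) ⟩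
    ℚ.∣ y - x ∣     ≤⟨ ∣prob-prob∣≤tv P R A ⟩
    tv P R          ≤⟨ ℚP.<⇒≤ tv<d ⟩
    d               ∎

count*c≤sumℚ : ∀ {n} (X : Subset n) (good : Fin n → Bool) (f : Fin n → ℚ) c →
  (∀ v → 0ℚ ≤ f v) → (∀ v → T (good v) → c ≤ f v) →
  sumℚ (λ v → if lookup X v then toℚ (𝟙 (good v)) else 0ℚ) * c ≤ sumℚ (λ v → if lookup X v then f v else 0ℚ)
count*c≤sumℚ X good f c 0≤f c≤f-good = begin
  sumℚ (λ v → if lookup X v then toℚ (𝟙 (good v)) else 0ℚ) * c
    ≡⟨ sumℚ-*ʳ (λ v → if lookup X v then toℚ (𝟙 (good v)) else 0ℚ) c ⟨
  sumℚ (λ v → (if lookup X v then toℚ (𝟙 (good v)) else 0ℚ) * c)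
    ≤⟨ sumℚ-mono-≤ per-vertex ⟩
  sumℚ (λ v → if lookup X v then f v else 0ℚ)
    ∎
  where
  open ℚP.≤-Reasoning
  per-vertex : ∀ v → (if lookup X v then toℚ (𝟙 (good v)) else 0ℚ) * c ≤ (if lookup X v then f v else 0ℚ)
  per-vertex v with lookup X v | good v | c≤f-good v
  ... | false | _     | _        = ℚP.≤-reflexive (ℚP.*-zeroˡ c)
  ... | true  | true  | c≤f-v    = ℚP.≤-trans (ℚP.≤-reflexive (ℚP.*-identityˡ c)) (c≤f-v tt)
  ... | true  | false | _        = ℚP.≤-trans (ℚP.≤-reflexive (ℚP.*-zeroˡ c)) (0≤f v)

mixed-mass-lower : ∀ {n} (P : Fin n → Dist n) (R : Dist n) d (X Y : Subset n) → (∀ v u → 0ℚ ≤ P v u) →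
  sumℚ (λ v → if lookup X v then toℚ (𝟙 (tv (P v) R <ᵇℚ d)) else 0ℚ) * (prob R Y - d)
    ≤ sumℚ (λ v → if lookup X v then prob (P v) Y else 0ℚ)
mixed-mass-lower P R d X Y 0≤P = count*c≤sumℚ X (λ v → tv (P v) R <ᵇℚ d) (λ v → prob (P v) Y) (prob R Y - d)
  (λ v → 0≤prob (P v) Y (0≤P v))
  (λ v mixed → tv<⇒prob-lower (P v) R Y (toWitness {a? = tv (P v) R ℚP.<? d} mixed))

-- Walkers escaping from a vertex set

module RandomWalk {n} (G : Graph n) where

  0≤Q : ∀ t v u → 0ℚ ≤ Q G t v u
  0≤Q zero v u with u == v
  ... | true  = ℚP.nonNegative⁻¹ 1ℚ
  ... | false = ℚP.≤-refl
  0≤Q (suc t) v u = 0≤sumℚ 0≤step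
    where
    0≤step : ∀ w → 0ℚ ≤ (if adj G w u then Q G t v w * inv (deg G w) else 0ℚ)
    0≤step w with adj G w u
    ... | true  = 0≤p*q (0≤Q t v w) (0≤inv (deg G w))
    ... | false = ℚP.≤-refl

  toℚ-eX : ∀ X Y → toℚ (eX G X Y) ≡
    sumℚ (λ x → sumℚ (λ y → if lookup X x then (if lookup Y y then toℚ (𝟙 (adj G x y)) else 0ℚ) else 0ℚ))
  toℚ-eX X Y = trans (toℚ-sumℕ (λ x → sumℕ (entry x))) (sumℚ-cong (λ x →
    trans (toℚ-sumℕ (entry x)) (sumℚ-cong (λ y →
      trans (if-float toℚ (lookup X x)) (if-cong-then (lookup X x) (if-float toℚ (lookup Y y)))))))
    where
    entry : Fin n → Fin n → ℕ
    entry x y = if lookup X x then (if lookup Y y then 𝟙 (adj G x y) else 0) else 0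

  eX-sym : ∀ X Y → toℚ (eX G X Y) ≡ toℚ (eX G Y X)
  eX-sym X Y = begin
    toℚ (eX G X Y)
      ≡⟨ toℚ-eX X Y ⟩
    sumℚ (λ x → sumℚ (λ y → if lookup X x then (if lookup Y y then toℚ (𝟙 (adj G x y)) else 0ℚ) else 0ℚ))
      ≡⟨ sumℚ-comm (λ x y → if lookup X x then (if lookup Y y then toℚ (𝟙 (adj G x y)) else 0ℚ) else 0ℚ) ⟩
    sumℚ (λ y → sumℚ (λ x → if lookup X x then (if lookup Y y then toℚ (𝟙 (adj G x y)) else 0ℚ) else 0ℚ))
      ≡⟨ sumℚ-cong (λ y → sumℚ-cong (λ x → trans (if-swap-then (lookup X x) (lookup Y y))
           (cong (λ b → if lookup Y y then (if lookup X x then toℚ (𝟙 b) else 0ℚ) else 0ℚ) (symm G x y)))) ⟩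
    sumℚ (λ y → sumℚ (λ x → if lookup Y y then (if lookup X x then toℚ (𝟙 (adj G y x)) else 0ℚ) else 0ℚ))
      ≡⟨ toℚ-eX Y X ⟨
    toℚ (eX G Y X)
      ∎
    where open ≡-Reasoning

  neighboursIn : Subset n → Fin n → ℚ
  neighboursIn Y w = sumℚ (λ u → if lookup Y u then toℚ (𝟙 (adj G w u)) else 0ℚ)

  toℚ-eX≡sum-neighboursIn : ∀ X Y → toℚ (eX G X Y) ≡ sumℚ (λ w → if lookup X w then neighboursIn Y w else 0ℚ)
  toℚ-eX≡sum-neighboursIn X Y = trans (toℚ-eX X Y) (sumℚ-cong (λ w →
    sym (if-sum (lookup X w) (λ u → if lookup Y u then toℚ (𝟙 (adj G w u)) else 0ℚ))))

  mass : Subset n → ℕ → Fin n → ℚ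
  mass X t u = sumℚ (λ v → if lookup X v then Q G t v u else 0ℚ)

  escape : Subset n → Subset n → ℕ → ℚ
  escape X Y t = sumℚ (λ u → if lookup Y u then mass X t u else 0ℚ)

  escape≡sum-prob : ∀ X Y t → escape X Y t ≡ sumℚ (λ v → if lookup X v then prob (Q G t v) Y else 0ℚ)
  escape≡sum-prob X Y t = begin
    escape X Y t
      ≡⟨ sumℚ-cong (λ u → if-sum (lookup Y u) (λ v → if lookup X v then Q G t v u else 0ℚ)) ⟩
    sumℚ (λ u → sumℚ (λ v → if lookup Y u then (if lookup X v then Q G t v u else 0ℚ) else 0ℚ))
      ≡⟨ sumℚ-comm (λ u v → if lookup Y u then (if lookup X v then Q G t v u else 0ℚ) else 0ℚ) ⟩
    sumℚ (λ v → sumℚ (λ u → if lookup Y u then (if lookup X v then Q G t v u else 0ℚ) else 0ℚ))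
      ≡⟨ sumℚ-cong (λ v → sumℚ-cong (λ u → if-swap-then (lookup Y u) (lookup X v))) ⟩
    sumℚ (λ v → sumℚ (λ u → if lookup X v then (if lookup Y u then Q G t v u else 0ℚ) else 0ℚ))
      ≡⟨ sumℚ-cong (λ v → if-sum (lookup X v) (λ u → if lookup Y u then Q G t v u else 0ℚ)) ⟨
    sumℚ (λ v → if lookup X v then prob (Q G t v) Y else 0ℚ)
      ∎
    where open ≡-Reasoning

  0≤mass : ∀ X t u → 0ℚ ≤ mass X t u
  0≤mass X t u = 0≤prob (λ v → Q G t v u) X (λ v → 0≤Q t v u)

  mass-zero : ∀ X u → mass X 0 u ≡ (if lookup X u then 1ℚ else 0ℚ)
  mass-zero X u = trans (sumℚ-cong (λ v → if-swap-then (lookup X v) (u == v)))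
    (sumℚ-delta u (λ v → if lookup X v then 1ℚ else 0ℚ))

  escape-zero : ∀ X → escape X (∁ X) 0 ≡ 0ℚ
  escape-zero X = trans (sumℚ-cong outside) (sumℚ-zero n)
    where
    outside : ∀ u → (if lookup (∁ X) u then mass X 0 u else 0ℚ) ≡ 0ℚ
    outside u rewrite mass-zero X u | lookup-map u not X with lookup X u
    ... | true  = refl
    ... | false = refl

  0≤neighboursIn : ∀ Y w → 0ℚ ≤ neighboursIn Y w
  0≤neighboursIn Y w = 0≤prob (λ u → toℚ (𝟙 (adj G w u))) Y (λ u → 0≤toℚ (𝟙 (adj G w u)))

  module Regular (d : ℕ) (regular : Regular G (suc d)) where

    1/D : ℚ
    1/D = inv (suc d)

    mass-suc : ∀ X t u → mass X (suc t) u ≡ sumℚ (λ w → if adj G w u then mass X t w * 1/D else 0ℚ)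
    mass-suc X t u = begin
      mass X (suc t) u
        ≡⟨ sumℚ-cong (λ v → if-sum (lookup X v) (move v)) ⟩
      sumℚ (λ v → sumℚ (λ w → if lookup X v then move v w else 0ℚ))
        ≡⟨ sumℚ-comm (λ v w → if lookup X v then move v w else 0ℚ) ⟩
      sumℚ (λ w → sumℚ (λ v → if lookup X v then move v w else 0ℚ))
        ≡⟨ sumℚ-cong incoming ⟩
      sumℚ (λ w → if adj G w u then mass X t w * 1/D else 0ℚ)
        ∎
      where
      open ≡-Reasoning
      move : Fin n → Fin n → ℚ
      move v w = if adj G w u then Q G t v w * inv (deg G w) else 0ℚ
      incoming : ∀ w → sumℚ (λ v → if lookup X v then move v w else 0ℚ) ≡ (if adj G w u then mass X t w * 1/D else 0ℚ)
      incoming w = begin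
        sumℚ (λ v → if lookup X v then move v w else 0ℚ)
          ≡⟨ sumℚ-cong (λ v → if-swap-then (lookup X v) (adj G w u)) ⟩
        sumℚ (λ v → if adj G w u then (if lookup X v then Q G t v w * inv (deg G w) else 0ℚ) else 0ℚ)
          ≡⟨ if-sum (adj G w u) (λ v → if lookup X v then Q G t v w * inv (deg G w) else 0ℚ) ⟨
        (if adj G w u then sumℚ (λ v → if lookup X v then Q G t v w * inv (deg G w) else 0ℚ) else 0ℚ)
          ≡⟨ if-cong-then (adj G w u) (trans (sumℚ-cong (λ v → if-*ʳ (lookup X v) (Q G t v w) (inv (deg G w))))
               (sumℚ-*ʳ (λ v → if lookup X v then Q G t v w else 0ℚ) (inv (deg G w)))) ⟩
        (if adj G w u then mass X t w * inv (deg G w) else 0ℚ)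
          ≡⟨ cong (λ k → if adj G w u then mass X t w * inv k else 0ℚ) (regular w) ⟩
        (if adj G w u then mass X t w * 1/D else 0ℚ)
          ∎

    sumℚ-adj-1/D≡1 : ∀ u → sumℚ (λ w → if adj G w u then 1/D else 0ℚ) ≡ 1ℚ
    sumℚ-adj-1/D≡1 u = begin
      sumℚ (λ w → if adj G w u then 1/D else 0ℚ)  ≡⟨ sumℚ-cong (λ w → if-𝟙 (adj G w u) 1/D) ⟩
      sumℚ (λ w → toℚ (𝟙 (adj G w u)) * 1/D)      ≡⟨ sumℚ-*ʳ (λ w → toℚ (𝟙 (adj G w u))) 1/D ⟩
      sumℚ (λ w → toℚ (𝟙 (adj G w u))) * 1/D      ≡⟨ cong (_* 1/D) (sumℚ-cong (λ w → cong (toℚ ∘ 𝟙) (symm G w u))) ⟩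
      sumℚ (λ w → toℚ (𝟙 (adj G u w))) * 1/D      ≡⟨ cong (_* 1/D) (toℚ-sumℕ (λ w → 𝟙 (adj G u w))) ⟨
      toℚ (deg G u) * 1/D                         ≡⟨ cong (λ k → toℚ k * 1/D) (regular u) ⟩
      toℚ (suc d) * 1/D                           ≡⟨ toℚ*inv≡1 (suc d) ⟩
      1ℚ                                          ∎
      where open ≡-Reasoning

    mass≤1 : ∀ X t u → mass X t u ≤ 1ℚ
    mass≤1 X zero u rewrite mass-zero X u with lookup X u
    ... | true  = ℚP.≤-refl
    ... | false = ℚP.nonNegative⁻¹ 1ℚ
    mass≤1 X (suc t) u rewrite mass-suc X t u =
      ℚP.≤-trans (sumℚ-mono-≤ step≤) (ℚP.≤-reflexive (sumℚ-adj-1/D≡1 u))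
      where
      step≤ : ∀ w → (if adj G w u then mass X t w * 1/D else 0ℚ) ≤ (if adj G w u then 1/D else 0ℚ)
      step≤ w with adj G w u
      ... | true  = ℚP.≤-trans (*-monoʳ-≤-0≤ 1/D (0≤inv (suc d)) (mass≤1 X t w)) (ℚP.≤-reflexive (ℚP.*-identityˡ 1/D))
      ... | false = ℚP.≤-refl

    neighboursIn≤D : ∀ Y w → neighboursIn Y w ≤ toℚ (suc d)
    neighboursIn≤D Y w = begin
      neighboursIn Y w                  ≤⟨ sumℚ-mono-≤ restrict≤ ⟩
      sumℚ (λ u → toℚ (𝟙 (adj G w u))) ≡⟨ toℚ-sumℕ (λ u → 𝟙 (adj G w u)) ⟨
      toℚ (deg G w)                     ≡⟨ cong toℚ (regular w) ⟩
      toℚ (suc d)                       ∎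
      where
      open ℚP.≤-Reasoning
      restrict≤ : ∀ u → (if lookup Y u then toℚ (𝟙 (adj G w u)) else 0ℚ) ≤ toℚ (𝟙 (adj G w u))
      restrict≤ u with lookup Y u
      ... | true  = ℚP.≤-refl
      ... | false = 0≤toℚ (𝟙 (adj G w u))

    escape-suc : ∀ X Y t → escape X Y (suc t) ≡ sumℚ (λ w → neighboursIn Y w * (mass X t w * 1/D))
    escape-suc X Y t = begin
      escape X Y (suc t)
        ≡⟨ sumℚ-cong (λ u → if-cong-then (lookup Y u) (mass-suc X t u)) ⟩
      sumℚ (λ u → if lookup Y u then sumℚ (λ w → if adj G w u then m w else 0ℚ) else 0ℚ)
        ≡⟨ sumℚ-cong (λ u → if-sum (lookup Y u) (λ w → if adj G w u then m w else 0ℚ)) ⟩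
      sumℚ (λ u → sumℚ (λ w → if lookup Y u then (if adj G w u then m w else 0ℚ) else 0ℚ))
        ≡⟨ sumℚ-comm (λ u w → if lookup Y u then (if adj G w u then m w else 0ℚ) else 0ℚ) ⟩
      sumℚ (λ w → sumℚ (λ u → if lookup Y u then (if adj G w u then m w else 0ℚ) else 0ℚ))
        ≡⟨ sumℚ-cong (λ w → sumℚ-cong (λ u → trans (if-cong-then (lookup Y u) (if-𝟙 (adj G w u) (m w)))
                                                      (if-*ʳ (lookup Y u) (toℚ (𝟙 (adj G w u))) (m w)))) ⟩
      sumℚ (λ w → sumℚ (λ u → (if lookup Y u then toℚ (𝟙 (adj G w u)) else 0ℚ) * m w))
        ≡⟨ sumℚ-cong (λ w → sumℚ-*ʳ (λ u → if lookup Y u then toℚ (𝟙 (adj G w u)) else 0ℚ) (m w)) ⟩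
      sumℚ (λ w → neighboursIn Y w * m w)
        ∎
      where
      open ≡-Reasoning
      m : Fin n → ℚ
      m w = mass X t w * 1/D

    escape-suc-term≤ : ∀ X t w → neighboursIn (∁ X) w * (mass X t w * 1/D)
      ≤ (if lookup (∁ X) w then mass X t w else 0ℚ) + (if lookup X w then neighboursIn (∁ X) w else 0ℚ) * 1/D
    escape-suc-term≤ X t w rewrite lookup-map w not X with lookup X w
    ... | true  = begin
      neighboursIn (∁ X) w * (mass X t w * 1/D) ≤⟨ *-monoˡ-≤-0≤ (neighboursIn (∁ X) w) (0≤neighboursIn (∁ X) w)
                                                      (*-monoʳ-≤-0≤ 1/D (0≤inv (suc d)) (mass≤1 X t w)) ⟩
      neighboursIn (∁ X) w * (1ℚ * 1/D)        ≡⟨ solve 2 (λ a c → a :* (con 1ℚ :* c) := con 0ℚ :+ a :* c) refl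
                                                      (neighboursIn (∁ X) w) 1/D ⟩
      0ℚ + neighboursIn (∁ X) w * 1/D          ∎
      where open ℚP.≤-Reasoning
    ... | false = begin
      neighboursIn (∁ X) w * (mass X t w * 1/D) ≤⟨ *-monoʳ-≤-0≤ (mass X t w * 1/D)
                                                      (0≤p*q (0≤mass X t w) (0≤inv (suc d))) (neighboursIn≤D (∁ X) w) ⟩
      toℚ (suc d) * (mass X t w * 1/D)         ≡⟨ solve 3 (λ D m c → D :* (m :* c) := m :* (D :* c)) refl
                                                      (toℚ (suc d)) (mass X t w) 1/D ⟩
      mass X t w * (toℚ (suc d) * 1/D)         ≡⟨ cong (mass X t w *_) (toℚ*inv≡1 (suc d)) ⟩
      mass X t w * 1ℚ                          ≡⟨ solve 2 (λ m c → m :* con 1ℚ := m :+ con 0ℚ :* c) refl (mass X t w) 1/D ⟩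
      mass X t w + 0ℚ * 1/D                    ∎
      where open ℚP.≤-Reasoning

    escape-step : ∀ X t → escape X (∁ X) (suc t) ≤ escape X (∁ X) t + toℚ (eX G X (∁ X)) * 1/D
    escape-step X t = begin
      escape X (∁ X) (suc t)
        ≡⟨ escape-suc X (∁ X) t ⟩
      sumℚ (λ w → neighboursIn (∁ X) w * (mass X t w * 1/D))
        ≤⟨ sumℚ-mono-≤ (escape-suc-term≤ X t) ⟩
      sumℚ (λ w → stay w + cross w * 1/D)
        ≡⟨ sumℚ-+ stay (λ w → cross w * 1/D) ⟩
      escape X (∁ X) t + sumℚ (λ w → cross w * 1/D)
        ≡⟨ cong (_+_ (escape X (∁ X) t)) (sumℚ-*ʳ cross 1/D) ⟩
      escape X (∁ X) t + sumℚ cross * 1/D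
        ≡⟨ cong (λ e → escape X (∁ X) t + e * 1/D) (toℚ-eX≡sum-neighboursIn X (∁ X)) ⟨
      escape X (∁ X) t + toℚ (eX G X (∁ X)) * 1/D
        ∎
      where
      open ℚP.≤-Reasoning
      stay cross : Fin n → ℚ
      stay  w = if lookup (∁ X) w then mass X t w else 0ℚ
      cross w = if lookup X w then neighboursIn (∁ X) w else 0ℚ

    escape≤ : ∀ X t → escape X (∁ X) t ≤ toℚ t * (toℚ (eX G X (∁ X)) * 1/D)
    escape≤ X zero    = ℚP.≤-reflexive (trans (escape-zero X) (sym (ℚP.*-zeroˡ (toℚ (eX G X (∁ X)) * 1/D))))
    escape≤ X (suc t) = begin
      escape X (∁ X) (suc t) ≤⟨ escape-step X t ⟩
      escape X (∁ X) t + e   ≤⟨ ℚP.+-monoˡ-≤ e (escape≤ X t) ⟩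
      toℚ t * e + e          ≡⟨ solve 2 (λ t e → t :* e :+ e := (con 1ℚ :+ t) :* e) refl (toℚ t) e ⟩
      (1ℚ + toℚ t) * e       ≡⟨ cong (_* e) (toℚ-+ 1 t) ⟨
      toℚ (suc t) * e        ∎
      where
      open ℚP.≤-Reasoning
      e = toℚ (eX G X (∁ X)) * 1/D

    escape-bound : ∀ X t →
      sumℚ (λ v → if lookup X v then prob (Q G t v) (∁ X) else 0ℚ) ≤ toℚ t * (toℚ (eX G X (∁ X)) * 1/D)
    escape-bound X t = subst (_≤ toℚ t * (toℚ (eX G X (∁ X)) * 1/D)) (escape≡sum-prob X (∁ X) t) (escape≤ X t)

    escape-bound-∁ : ∀ X t →
      sumℚ (λ v → if lookup (∁ X) v then prob (Q G t v) X else 0ℚ) ≤ toℚ t * (toℚ (eX G X (∁ X)) * 1/D)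
    escape-bound-∁ X t = subst₂ (λ Y e → sumℚ (λ v → if lookup (∁ X) v then prob (Q G t v) Y else 0ℚ) ≤ toℚ t * (e * 1/D))
      (∁-involutive X)
      (trans (cong (toℚ ∘ eX G (∁ X)) (∁-involutive X)) (eX-sym (∁ X) X))
      (escape-bound (∁ X) t)

-- The counting argument

-- κ − 2δ ≥ κ/2 gives Bκ ≤ 2E and 1 − κ − 2δ ≥ 2/5 gives A ≤ 5E/2, so εκN ≤ κ(A + B) ≤ A/2 + 2E ≤ 8E.
-- Each inequality is certified by writing its slack as a sum of products of nonnegative terms.
εκN≤8E : ∀ {ε δ κ N A B E} → 0ℚ ≤ κ → 0ℚ ≤ A → 0ℚ ≤ B → 0ℚ ≤ E →
  δ ≤ + 1 / 20 → + 4 / 1 * δ ≤ κ → κ ≤ + 1 / 2 → ε * N ≤ A + B →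
  A * (1ℚ - κ - + 2 / 1 * δ) ≤ E → B * (κ - + 2 / 1 * δ) ≤ E →
  ε * (κ * N) ≤ + 8 / 1 * E
εκN≤8E {ε} {δ} {κ} {N} {A} {B} {E} 0≤κ 0≤A 0≤B 0≤E δ≤1/20 4δ≤κ κ≤1/2 εN≤A+B A-escape B-escape =
  ≤-by-slack (κ * (A + B - ε * N) + (+ 2 / 1 * E - B * κ) + A * (+ 1 / 2 - κ) + + 1 / 2 * (+ 5 / 2 * E - A) + + 19 / 4 * E)
    (0≤p+q (0≤p+q (0≤p+q (0≤p+q (0≤p*q 0≤κ (p≤q⇒0≤q-p εN≤A+B)) (p≤q⇒0≤q-p Bκ≤2E))
      (0≤p*q 0≤A (p≤q⇒0≤q-p κ≤1/2))) (0≤p*q (ℚP.nonNegative⁻¹ (+ 1 / 2)) (p≤q⇒0≤q-p A≤5/2E)))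
      (0≤p*q (ℚP.nonNegative⁻¹ (+ 19 / 4)) 0≤E))
    (solve 6 (λ ε κ N A B E →
      ε :* (κ :* N) :+ (κ :* (A :+ B :- ε :* N) :+ (con (+ 2 / 1) :* E :- B :* κ) :+ A :* (con (+ 1 / 2) :- κ)
        :+ con (+ 1 / 2) :* (con (+ 5 / 2) :* E :- A) :+ con (+ 19 / 4) :* E) := con (+ 8 / 1) :* E)
      refl ε κ N A B E)
  where
  Bκ≤2E : B * κ ≤ + 2 / 1 * E
  Bκ≤2E = ≤-by-slack (+ 2 / 1 * (E - B * (κ - + 2 / 1 * δ)) + B * (κ - + 4 / 1 * δ))
    (0≤p+q (0≤p*q (ℚP.nonNegative⁻¹ (+ 2 / 1)) (p≤q⇒0≤q-p B-escape)) (0≤p*q 0≤B (p≤q⇒0≤q-p 4δ≤κ)))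
    (solve 4 (λ B κ E δ →
      B :* κ :+ (con (+ 2 / 1) :* (E :- B :* (κ :- con (+ 2 / 1) :* δ)) :+ B :* (κ :- con (+ 4 / 1) :* δ))
        := con (+ 2 / 1) :* E)
      refl B κ E δ)
  A≤5/2E : A ≤ + 5 / 2 * E
  A≤5/2E = ≤-by-slack
    (+ 5 / 2 * (E - A * (1ℚ - κ - + 2 / 1 * δ)) + + 5 / 2 * (A * (+ 1 / 2 - κ)) + + 5 / 1 * (A * (+ 1 / 20 - δ)))
    (0≤p+q (0≤p+q (0≤p*q (ℚP.nonNegative⁻¹ (+ 5 / 2)) (p≤q⇒0≤q-p A-escape))
                  (0≤p*q (ℚP.nonNegative⁻¹ (+ 5 / 2)) (0≤p*q 0≤A (p≤q⇒0≤q-p κ≤1/2))))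
           (0≤p*q (ℚP.nonNegative⁻¹ (+ 5 / 1)) (0≤p*q 0≤A (p≤q⇒0≤q-p δ≤1/20))))
    (solve 4 (λ A κ E δ →
      A :+ (con (+ 5 / 2) :* (E :- A :* (con 1ℚ :- κ :- con (+ 2 / 1) :* δ)) :+ con (+ 5 / 2) :* (A :* (con (+ 1 / 2) :- κ))
        :+ con (+ 5 / 1) :* (A :* (con (+ 1 / 20) :- δ))) := con (+ 5 / 2) :* E)
      refl A κ E δ)

scale-by-D/8τ : ∀ ε K e d τ → ε * K ≤ + 8 / 1 * (toℚ (suc τ) * (e * inv (suc d))) →
  ε * toℚ (suc d) * inv (8 ℕ.* suc τ) * K ≤ e
scale-by-D/8τ ε K e d τ εK≤8E = begin
  ε * D * i * K
    ≡⟨ solve 4 (λ ε D i K → ε :* D :* i :* K := ε :* K :* (D :* i)) refl ε D i K ⟩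
  ε * K * (D * i)
    ≤⟨ *-monoʳ-≤-0≤ (D * i) (0≤p*q (0≤toℚ (suc d)) (0≤inv (8 ℕ.* suc τ))) εK≤8E ⟩
  + 8 / 1 * (t * (e * c)) * (D * i)
    ≡⟨ solve 5 (λ t e c D i → con (+ 8 / 1) :* (t :* (e :* c)) :* (D :* i) := e :* (con (+ 8 / 1) :* t :* i) :* (D :* c))
         refl t e c D i ⟩
  e * (+ 8 / 1 * t * i) * (D * c)
    ≡⟨ cong (λ x → e * (x * i) * (D * c)) (toℚ-* 8 (suc τ)) ⟨
  e * (toℚ (8 ℕ.* suc τ) * i) * (D * c)
    ≡⟨ cong₂ (λ x y → e * x * y) (toℚ*inv≡1 (8 ℕ.* suc τ)) (toℚ*inv≡1 (suc d)) ⟩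
  e * 1ℚ * 1ℚ
    ≡⟨ solve 1 (λ e → e :* con 1ℚ :* con 1ℚ := e) refl e ⟩
  e ∎
  where
  open ℚP.≤-Reasoning
  D t c i : ℚ
  D = toℚ (suc d)
  t = toℚ (suc τ)
  c = inv (suc d)
  i = inv (8 ℕ.* suc τ)

expansion-bound : ∀ {k} (G : Graph (suc k)) d → Regular G (suc d) → ∀ ε δ τ → δ ≤ + 1 / 20 →
  ε * toℚ (suc k) ≤ toℚ (countV (λ v → tv (Q G τ v) (Unif (suc k)) <ᵇℚ (+ 2 / 1 * δ))) →
  (X : Subset (suc k)) → + 4 / 1 * δ * toℚ (suc k) ≤ toℚ ∣ X ∣ → toℚ ∣ X ∣ ≤ + 1 / 2 * toℚ (suc k) →
  ε * toℚ ∣ X ∣ ≤ + 8 / 1 * (toℚ τ * (toℚ (eX G X (∁ X)) * inv (suc d)))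
expansion-bound {k} G d regular ε δ τ δ≤1/20 many-mixed X 4δn≤∣X∣ ∣X∣≤n/2 =
  subst (λ K → ε * K ≤ + 8 / 1 * E) κn≡∣X∣
    (εκN≤8E {ε} {N = toℚ n} 0≤κ 0≤a 0≤b 0≤E δ≤1/20 4δ≤κ κ≤1/2 εn≤a+b a-escape b-escape)
  where
  open RandomWalk G
  open Regular d regular
  n = suc k
  mixed : Fin n → Bool
  mixed v = tv (Q G τ v) (Unif n) <ᵇℚ (+ 2 / 1 * δ)
  -- the probability of X under an indicator function is a count
  a b κ E : ℚ
  a = prob (toℚ ∘ 𝟙 ∘ mixed) X
  b = prob (toℚ ∘ 𝟙 ∘ mixed) (∁ X)
  κ = prob (Unif n) X
  E = toℚ τ * (toℚ (eX G X (∁ X)) * 1/D)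
  0≤a : 0ℚ ≤ a
  0≤a = 0≤prob (toℚ ∘ 𝟙 ∘ mixed) X (0≤toℚ ∘ 𝟙 ∘ mixed)
  0≤b : 0ℚ ≤ b
  0≤b = 0≤prob (toℚ ∘ 𝟙 ∘ mixed) (∁ X) (0≤toℚ ∘ 𝟙 ∘ mixed)
  0≤κ : 0ℚ ≤ κ
  0≤κ = 0≤prob (Unif n) X (λ _ → 0≤inv n)
  0≤E : 0ℚ ≤ E
  0≤E = 0≤p*q (0≤toℚ τ) (0≤p*q (0≤toℚ (eX G X (∁ X))) (0≤inv (suc d)))
  4δ≤κ : + 4 / 1 * δ ≤ κ
  4δ≤κ = subst (_ ≤_) (sym (prob-Unif X)) (p*n≤q⇒p≤q*inv-n n 4δn≤∣X∣)
  κ≤1/2 : κ ≤ + 1 / 2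
  κ≤1/2 = subst (_≤ _) (sym (prob-Unif X)) (p≤q*n⇒p*inv-n≤q n ∣X∣≤n/2)
  κn≡∣X∣ : κ * toℚ n ≡ toℚ ∣ X ∣
  κn≡∣X∣ = trans (cong (_* toℚ n) (prob-Unif X)) (x*inv-n*n≡x (toℚ ∣ X ∣) n)
  εn≤a+b : ε * toℚ n ≤ a + b
  εn≤a+b = subst (ε * toℚ n ≤_) (trans (toℚ-sumℕ (𝟙 ∘ mixed)) (sumℚ-split X (toℚ ∘ 𝟙 ∘ mixed))) many-mixed
  1-κ≡U∁X : 1ℚ - κ ≡ prob (Unif n) (∁ X)
  1-κ≡U∁X = sym (trans (prob-∁ (Unif n) X) (cong (_- κ) (sumℚ-Unif k)))
  a-escape : a * (1ℚ - κ - + 2 / 1 * δ) ≤ E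
  a-escape = ℚP.≤-trans (ℚP.≤-reflexive (cong (λ μ → a * (μ - + 2 / 1 * δ)) 1-κ≡U∁X))
    (ℚP.≤-trans (mixed-mass-lower (Q G τ) (Unif n) (+ 2 / 1 * δ) X (∁ X) (0≤Q τ)) (escape-bound X τ))
  b-escape : b * (κ - + 2 / 1 * δ) ≤ E
  b-escape = ℚP.≤-trans (mixed-mass-lower (Q G τ) (Unif n) (+ 2 / 1 * δ) (∁ X) X (0≤Q τ)) (escape-bound-∁ X τ)

theorem3p1 : (ε δ : ℚ) → 0ℚ < ε → ε < + 2 / 5 → 0ℚ < δ → δ ≤ + 1 / 20 →
    (τ : ℕ) → 1 ℕ.≤ τ → (D n : ℕ) → 1 ℕ.≤ D → (G : Graph n) →
    Connected G → Regular G D →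
    ε * toℚ n ≤ toℚ (countV (λ v → tv (Q G τ v) (Unif n) <ᵇℚ (+ 2 / 1 * δ))) →
    (X : Subset n) → + 4 / 1 * δ * toℚ n ≤ toℚ ∣ X ∣ → toℚ ∣ X ∣ ≤ + 1 / 2 * toℚ n →
    (ε * toℚ D) * inv (8 ℕ.* τ) * toℚ ∣ X ∣ ≤ toℚ (eX G X (∁ X))
theorem3p1 ε δ _ _ _ _ (suc τ) _ (suc d) zero _ G _ _ _ [] _ _ =
  subst (_≤ toℚ (eX G [] [])) (sym (ℚP.*-zeroʳ (ε * toℚ (suc d) * inv (8 ℕ.* suc τ)))) (0≤toℚ (eX G [] []))
theorem3p1 ε δ _ _ _ δ≤1/20 (suc τ) _ (suc d) (suc k) _ G _ regular many-mixed X 4δn≤∣X∣ ∣X∣≤n/2 =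
  scale-by-D/8τ ε (toℚ ∣ X ∣) (toℚ (eX G X (∁ X))) d τ
    (expansion-bound G d regular ε δ (suc τ) δ≤1/20 many-mixed X 4δn≤∣X∣ ∣X∣≤n/2)
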